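{- Let $h$ be a fixed integer and let $G$ be a graph (undirected or directed) with $t$ copies of an $h$-cycle, and let $x$ be the number of vertices participating in at least one $h$-cycle. For $\ell\in[h+1,2h]$ let $\mathcal D^\ell$ be the number of pairs of copies of an $h$-cycle in $G$ whose vertex sets have a union of exactly $\ell$ vertices. Then for every $i\in[h+1,2h-1]$, $\mathcal D^i\le (2h)^h\cdot t\cdot x^{i-h}$.
   Context: A copy of an $h$-cycle is a subgraph of $G$ isomorphic to the cycle on $h$ vertices (directed cycle if $G$ is directed). -}

module Defs where

open import Data.Nat using (ℕ; zero; suc; _+_; _*_; _∸_; _^_; _≤_)
open import Data.Nat.DivMod using (_mod_)
open import Data.Bool using (Bool; true; false; _∨_)
open import Data.Fin using (Fin; toℕ) renaming (zero to fz; suc to fs)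
open import Data.Fin.Subset using (Subset; _∪_; ∣_∣)
open import Data.Vec using (Vec; lookup; tabulate)
open import Data.List using (List; length)
open import Data.List.Relation.Unary.Unique.Propositional using (Unique)
open import Data.List.Membership.Propositional using (_∈_)
open import Data.Product using (Σ; _×_; _,_)
open import Data.Sum using (_⊎_)
open import Data.Unit using (⊤)
open import Function.Bundles using (_⇔_)
open import Function.Definitions using (Injective)
open import Relation.Binary.PropositionalEquality using (_≡_)

Card : {A : Set} → (A → Set) → ℕ → Set
Card {A} P k = Σ (List A) λ L → Unique L × (∀ a → (a ∈ L) ⇔ P a) × length L ≡ k

data Kind : Set where
  directed undirected : Kind

Adj : ℕ → Set
Adj n = Fin n → Fin n → Bool

WellFormed : {n : ℕ} → Kind → Adj n → Set
WellFormed directed    a = ⊤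
WellFormed undirected a = (∀ u v → a u v ≡ a v u) × (∀ v → a v v ≡ false)

minLen : Kind → ℕ
minLen directed   = 2
minLen undirected = 3

next : {h : ℕ} → Fin h → Fin h
next {suc m} k = suc (toℕ k) mod (suc m)

EdgeSet : ℕ → Set
EdgeSet n = Vec (Vec Bool n) n

_∋[_,_] : {n : ℕ} → EdgeSet n → Fin n → Fin n → Bool
S ∋[ u , v ] = lookup (lookup S u) v

CycEdge : {n h : ℕ} → Kind → (Fin h → Fin n) → Fin n → Fin n → Set
CycEdge {h = h} directed   f u v = Σ (Fin h) λ k → u ≡ f k × v ≡ f (next k)
CycEdge {h = h} undirected f u v =
  Σ (Fin h) λ k → (u ≡ f k × v ≡ f (next k)) ⊎ (v ≡ f k × u ≡ f (next k))

IsCopy : {n : ℕ} → Kind → Adj n → (h : ℕ) → EdgeSet n → Set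
IsCopy {n} K a h S =
  (∀ u v → S ∋[ u , v ] ≡ true → a u v ≡ true) ×
  Σ (Fin h → Fin n) λ f → Injective _≡_ _≡_ f ×
    (∀ u v → (S ∋[ u , v ] ≡ true) ⇔ CycEdge K f u v)

anyB : {n : ℕ} → (Fin n → Bool) → Bool
anyB {zero}  f = false
anyB {suc n} f = f fz ∨ anyB (λ i → f (fs i))

vset : {n : ℕ} → EdgeSet n → Subset n
vset S = tabulate λ v → anyB λ u → S ∋[ v , u ] ∨ S ∋[ u , v ]

InSomeCopy : {n : ℕ} → Kind → Adj n → (h : ℕ) → Fin n → Set
InSomeCopy K a h v = Σ (EdgeSet _) λ S → IsCopy K a h S × lookup (vset S) v ≡ true

-- (ordered) pairs of copies whose vertex sets have union of size exactly ℓ.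
PairUnion : {n : ℕ} → Kind → Adj n → (h ℓ : ℕ) → EdgeSet n × EdgeSet n → Set
PairUnion K a h ℓ (S , T) =
  IsCopy K a h S × IsCopy K a h T × ∣ vset S ∪ vset T ∣ ≡ ℓ

{-# OPTIONS --safe #-}
-- Fix an ordered pair (S , T) of copies whose vertex sets have a union of h + m
-- vertices. Then T has at most m vertices outside S, each lying on some copy, so T
-- is recovered from: S (t choices); a word of m vertices lying on copies that lists
-- the vertices of T outside S (x^m choices); and, for each of the h positions along
-- the cycle T, which of the h + m vertices of S followed by that word sits there
-- ((h + m)^h choices). Hence the count is at most t · x^m · (h + m)^h ≤ (2h)^h · t · x^m.
module Submission where

open import Data.Bool using (Bool; true; false; _∨_)
open import Data.Bool.Properties using (∨-zeroʳ) renaming (_≟_ to _≟ᴮ_)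
open import Data.Empty using (⊥-elim)
open import Data.Fin using (Fin; _↑ˡ_; _↑ʳ_; fromℕ<) renaming (zero to fz; suc to fs)
open import Data.Fin.Properties using (any?) renaming (_≟_ to _≟ᶠ_)
open import Data.Fin.Subset using (Subset; _∪_; ∣_∣)
open import Data.List as List using (List; []; _∷_; [_]; length; allFin; filter; _++_; cartesianProductWith; cartesianProduct)
open import Data.List.Membership.Propositional using (_∈_)
open import Data.List.Membership.Propositional.Properties
  using (∈-map⁺; ∈-++⁻; ∈-tabulate⁺; ∈-tabulate⁻; ∈-filter⁺; ∈-filter⁻; ∈-lookup; ∈-allFin;
         ∈-cartesianProductWith⁺; ∈-cartesianProduct⁺)
open import Data.List.Properties using (length-++; length-map; length-tabulate; length-removeAt′)
open import Data.List.Relation.Binary.Disjoint.Propositional using (Disjoint)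
open import Data.List.Relation.Binary.Subset.Propositional using (_⊆_)
open import Data.List.Relation.Unary.All as All using ()
open import Data.List.Relation.Unary.AllPairs using ([]; _∷_)
open import Data.List.Relation.Unary.Any using (here; there; _─_; index)
open import Data.List.Relation.Unary.Any.Properties using (lookup-index)
open import Data.List.Relation.Unary.Unique.Propositional using (Unique)
open import Data.List.Relation.Unary.Unique.Propositional.Properties using (tabulate⁺; filter⁺; ++⁺)
open import Data.Nat using (ℕ; zero; suc; _+_; _*_; _∸_; _^_; _≤_; z≤n; s≤s; NonZero; >-nonZero⁻¹)
open import Data.Nat.Properties
  using (≤-trans; ≤-reflexive; m≤m+n; m∸n≤m; m+[n∸m]≡n; +-cancelˡ-≤; *-monoʳ-≤; ^-monoˡ-≤; module ≤-Reasoning)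
open import Data.Nat.Tactic.RingSolver using (solve-∀)
open import Data.Product using (∃; _×_; _,_; proj₁; proj₂)
open import Data.Sum using (_⊎_; inj₁; inj₂)
open import Data.Vec as Vec using (Vec; []; _∷_; lookup)
open import Data.Vec.Properties using (lookup-zipWith; lookup-++ˡ; lookup-++ʳ; lookup∘tabulate; tabulate∘lookup; tabulate-cong)
open import Function using (_∘_; id)
open import Function.Bundles using (_⇔_; mk⇔; Equivalence)
open import Function.Definitions using (Injective)
open import Relation.Binary.PropositionalEquality using (_≡_; _≢_; refl; sym; trans; cong; cong₂; subst; _≗_; module ≡-Reasoning)
open import Relation.Nullary using (Dec; yes; no)
open import Relation.Unary using (Decidable)
open import Relation.Nullary.Decidable using (⌊_⌋; _×-dec_; _⊎-dec_)
open import Defs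

module _ {A : Set} where

  ∈-─ : ∀ {x y : A} {ys} (x∈ys : x ∈ ys) → x ≢ y → y ∈ ys → y ∈ (ys ─ x∈ys)
  ∈-─ (here refl) x≢y (here refl)  = ⊥-elim (x≢y refl)
  ∈-─ (here refl) x≢y (there y∈ys) = y∈ys
  ∈-─ (there x∈ys) x≢y (here refl)  = here refl
  ∈-─ (there x∈ys) x≢y (there y∈ys) = there (∈-─ x∈ys x≢y y∈ys)

  Unique-⊆⇒length≤ : ∀ {xs ys : List A} → Unique xs → xs ⊆ ys → length xs ≤ length ys
  Unique-⊆⇒length≤ [] _ = z≤n
  Unique-⊆⇒length≤ {x ∷ xs} {ys} (x∉xs ∷ xs-unique) xs⊆ys = begin
    suc (length xs)          ≤⟨ s≤s (Unique-⊆⇒length≤ xs-unique xs⊆ys─x) ⟩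
    suc (length (ys ─ x∈ys)) ≡⟨ length-removeAt′ ys (index x∈ys) ⟨
    length ys                ∎
    where
    open ≤-Reasoning
    x∈ys : x ∈ ys
    x∈ys = xs⊆ys (here refl)
    xs⊆ys─x : xs ⊆ (ys ─ x∈ys)
    xs⊆ys─x y∈xs = ∈-─ x∈ys (All.lookup x∉xs y∈xs) (xs⊆ys (there y∈xs))

  length-cartesianProductWith : ∀ {B C : Set} (f : A → B → C) xs ys →
    length (cartesianProductWith f xs ys) ≡ length xs * length ys
  length-cartesianProductWith f []       ys = refl
  length-cartesianProductWith f (x ∷ xs) ys = begin
    length (List.map (f x) ys ++ cartesianProductWith f xs ys)
      ≡⟨ length-++ (List.map (f x) ys) ⟩
    length (List.map (f x) ys) + length (cartesianProductWith f xs ys)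
      ≡⟨ cong₂ _+_ (length-map (f x) ys) (length-cartesianProductWith f xs ys) ⟩
    length ys + length xs * length ys
      ∎
    where open ≡-Reasoning

  length-cartesianProduct : ∀ {B : Set} (xs : List A) (ys : List B) →
    length (cartesianProduct xs ys) ≡ length xs * length ys
  length-cartesianProduct = length-cartesianProductWith _,_

  vectorsOver : List A → (k : ℕ) → List (Vec A k)
  vectorsOver xs zero    = [ [] ]
  vectorsOver xs (suc k) = cartesianProductWith _∷_ xs (vectorsOver xs k)

  length-vectorsOver : ∀ xs k → length (vectorsOver xs k) ≡ length xs ^ k
  length-vectorsOver xs zero    = refl
  length-vectorsOver xs (suc k) =
    trans (length-cartesianProductWith _∷_ xs (vectorsOver xs k))
          (cong (length xs *_) (length-vectorsOver xs k))

  ∈-vectorsOver⁺ : ∀ {xs k} (v : Vec A k) → (∀ i → lookup v i ∈ xs) → v ∈ vectorsOver xs k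
  ∈-vectorsOver⁺ []      _    = here refl
  ∈-vectorsOver⁺ (x ∷ v) v⊆xs = ∈-cartesianProductWith⁺ _∷_ (v⊆xs fz) (∈-vectorsOver⁺ v (v⊆xs ∘ fs))

  -- d pads w when xs is shorter than m.
  vectorsOver-covers : ∀ {d : A} {ys} xs m → d ∈ ys → xs ⊆ ys → length xs ≤ m →
    ∃ λ w → w ∈ vectorsOver ys m × ∀ {x} → x ∈ xs → ∃ λ r → lookup w r ≡ x
  vectorsOver-covers []       zero    d∈ys xs⊆ys _ = [] , here refl , λ ()
  vectorsOver-covers {d} []   (suc m) d∈ys xs⊆ys _
    with w , w∈ , _ ← vectorsOver-covers [] m d∈ys xs⊆ys z≤n
    = d ∷ w , ∈-cartesianProductWith⁺ _∷_ d∈ys w∈ , λ ()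
  vectorsOver-covers (x ∷ xs) (suc m) d∈ys xs⊆ys (s≤s len≤m)
    with w , w∈ , covers ← vectorsOver-covers xs m d∈ys (xs⊆ys ∘ there) len≤m
    = x ∷ w , ∈-cartesianProductWith⁺ _∷_ (xs⊆ys (here refl)) w∈ , λ where
        (here refl)  → fz , refl
        (there x∈xs) → let r , eq = covers x∈xs in fs r , eq

length-allFin : ∀ n → length (allFin n) ≡ n
length-allFin n = length-tabulate id

members : ∀ {n} → Subset n → List (Fin n)
members []          = []
members (true ∷ p)  = fz ∷ List.map fs (members p)
members (false ∷ p) = List.map fs (members p)

length-members : ∀ {n} (p : Subset n) → length (members p) ≡ ∣ p ∣
length-members []          = refl
length-members (true ∷ p)  = cong suc (trans (length-map fs (members p)) (length-members p))
length-members (false ∷ p) = trans (length-map fs (members p)) (length-members p)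

∈-members : ∀ {n} (p : Subset n) {v} → lookup p v ≡ true → v ∈ members p
∈-members (true ∷ p)  {fz}   _  = here refl
∈-members (true ∷ p)  {fs v} pv = there (∈-map⁺ fs (∈-members p pv))
∈-members (false ∷ p) {fs v} pv = ∈-map⁺ fs (∈-members p pv)

Unique⇒length≤∣∣ : ∀ {n} {xs : List (Fin n)} (p : Subset n) →
  Unique xs → (∀ {v} → v ∈ xs → lookup p v ≡ true) → length xs ≤ ∣ p ∣
Unique⇒length≤∣∣ {xs = xs} p xs-unique xs⊆p =
  subst (length xs ≤_) (length-members p) (Unique-⊆⇒length≤ xs-unique (∈-members p ∘ xs⊆p))

∪-trueˡ : ∀ {n} (p q : Subset n) {v} → lookup p v ≡ true → lookup (p ∪ q) v ≡ true
∪-trueˡ p q {v} pv rewrite lookup-zipWith _∨_ v p q | pv = refl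

∪-trueʳ : ∀ {n} (p q : Subset n) {v} → lookup q v ≡ true → lookup (p ∪ q) v ≡ true
∪-trueʳ p q {v} qv rewrite lookup-zipWith _∨_ v p q | qv = ∨-zeroʳ (lookup p v)

CycEdge? : ∀ {n h} (K : Kind) (f : Fin h → Fin n) u v → Dec (CycEdge K f u v)
CycEdge? directed   f u v = any? λ k → (u ≟ᶠ f k) ×-dec (v ≟ᶠ f (next k))
CycEdge? undirected f u v = any? λ k →
  ((u ≟ᶠ f k) ×-dec (v ≟ᶠ f (next k))) ⊎-dec ((v ≟ᶠ f k) ×-dec (u ≟ᶠ f (next k)))

cycleEdges : ∀ {n h} → Kind → (Fin h → Fin n) → EdgeSet n
cycleEdges K f = Vec.tabulate λ u → Vec.tabulate λ v → ⌊ CycEdge? K f u v ⌋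

IsCycleEdges : ∀ {n h} → Kind → (Fin h → Fin n) → EdgeSet n → Set
IsCycleEdges K f S = ∀ u v → (S ∋[ u , v ] ≡ true) ⇔ CycEdge K f u v

CycEdge-resp-≗ : ∀ {n h} (K : Kind) {f g : Fin h → Fin n} → f ≗ g → ∀ {u v} → CycEdge K f u v → CycEdge K g u v
CycEdge-resp-≗ directed   f≗g (k , u≡ , v≡)        = k , trans u≡ (f≗g k) , trans v≡ (f≗g (next k))
CycEdge-resp-≗ undirected f≗g (k , inj₁ (u≡ , v≡)) = k , inj₁ (trans u≡ (f≗g k) , trans v≡ (f≗g (next k)))
CycEdge-resp-≗ undirected f≗g (k , inj₂ (v≡ , u≡)) = k , inj₂ (trans v≡ (f≗g k) , trans u≡ (f≗g (next k)))

IsCycleEdges-resp-≗ : ∀ {n h} (K : Kind) {f g : Fin h → Fin n} S → f ≗ g → IsCycleEdges K f S → IsCycleEdges K g S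
IsCycleEdges-resp-≗ K S f≗g S=f u v = mk⇔
  (CycEdge-resp-≗ K f≗g ∘ Equivalence.to (S=f u v))
  (Equivalence.from (S=f u v) ∘ CycEdge-resp-≗ K (sym ∘ f≗g))

IsCycleEdges⇒≡cycleEdges : ∀ {n h} (K : Kind) {f : Fin h → Fin n} {S} → IsCycleEdges K f S → S ≡ cycleEdges K f
IsCycleEdges⇒≡cycleEdges K {f} {S} S=f = begin
  S                                                    ≡⟨ tabulate∘lookup S ⟨
  Vec.tabulate (lookup S)                              ≡⟨ tabulate-cong (tabulate∘lookup ∘ lookup S) ⟨
  Vec.tabulate (λ u → Vec.tabulate λ v → S ∋[ u , v ]) ≡⟨ tabulate-cong (λ u → tabulate-cong λ v →
                                                            ≡⌊⌋ (S=f u v) (CycEdge? K f u v)) ⟩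
  cycleEdges K f                                       ∎
  where
  open ≡-Reasoning
  ≡⌊⌋ : ∀ {P : Set} {b} → (b ≡ true) ⇔ P → (P? : Dec P) → b ≡ ⌊ P? ⌋
  ≡⌊⌋ {b = true}  b⇔P (no ¬p) = ⊥-elim (¬p (Equivalence.to b⇔P refl))
  ≡⌊⌋ {b = false} b⇔P (yes p) = Equivalence.from b⇔P p
  ≡⌊⌋ {b = true}  b⇔P (yes p) = refl
  ≡⌊⌋ {b = false} b⇔P (no ¬p) = refl

anyB⁺ : ∀ {n} (f : Fin n → Bool) {k} → f k ≡ true → anyB f ≡ true
anyB⁺ f {fz}   fk rewrite fk = refl
anyB⁺ f {fs k} fk with f fz
... | true  = refl
... | false = anyB⁺ (f ∘ fs) fk

anyB⁻ : ∀ {n} (f : Fin n → Bool) → anyB f ≡ true → ∃ λ k → f k ≡ true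
anyB⁻ {suc n} f any-f with f fz in f0
... | true  = fz , f0
... | false = let k , fk = anyB⁻ (f ∘ fs) any-f in fs k , fk

_∈ᵥ_ : ∀ {n} → Fin n → EdgeSet n → Set
v ∈ᵥ S = lookup (vset S) v ≡ true

source∈ᵥ : ∀ {n} {S : EdgeSet n} {u v} → S ∋[ u , v ] ≡ true → u ∈ᵥ S
source∈ᵥ {S = S} {u} {v} uv∈S =
  trans (lookup∘tabulate _ u) (anyB⁺ (λ w → S ∋[ u , w ] ∨ S ∋[ w , u ]) (cong (_∨ S ∋[ v , u ]) uv∈S))

∈ᵥ⇒incident : ∀ {n} {S : EdgeSet n} {v} → v ∈ᵥ S → ∃ λ u → S ∋[ v , u ] ≡ true ⊎ S ∋[ u , v ] ≡ true
∈ᵥ⇒incident {S = S} {v} v∈S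
  with u , incident ← anyB⁻ _ (trans (sym (lookup∘tabulate _ v)) v∈S)
  = u , ∨-true (S ∋[ v , u ]) incident
  where
  ∨-true : ∀ a {b} → a ∨ b ≡ true → a ≡ true ⊎ b ≡ true
  ∨-true true  _   = inj₁ refl
  ∨-true false b≡t = inj₂ b≡t

CycEdge-step : ∀ {n h} (K : Kind) (f : Fin h → Fin n) k → CycEdge K f (f k) (f (next k))
CycEdge-step directed   f k = k , refl , refl
CycEdge-step undirected f k = k , inj₁ (refl , refl)

CycEdge-endpoints : ∀ {n h} (K : Kind) {f : Fin h → Fin n} {u v} → CycEdge K f u v →
  (∃ λ k → u ≡ f k) × (∃ λ k → v ≡ f k)
CycEdge-endpoints directed   (k , u≡ , v≡)        = (k , u≡) , (next k , v≡)
CycEdge-endpoints undirected (k , inj₁ (u≡ , v≡)) = (k , u≡) , (next k , v≡)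
CycEdge-endpoints undirected (k , inj₂ (v≡ , u≡)) = (next k , u≡) , (k , v≡)

module _ {n h} {K : Kind} {f : Fin h → Fin n} (S : EdgeSet n) (S=f : IsCycleEdges K f S) where

  image⊆vset : ∀ k → f k ∈ᵥ S
  image⊆vset k = source∈ᵥ {S = S} (Equivalence.from (S=f _ _) (CycEdge-step K f k))

  vset⊆image : ∀ {v} → v ∈ᵥ S → ∃ λ k → v ≡ f k
  vset⊆image v∈S with ∈ᵥ⇒incident {S = S} v∈S
  ... | u , inj₁ vu∈S = proj₁ (CycEdge-endpoints K (Equivalence.to (S=f _ u) vu∈S))
  ... | u , inj₂ uv∈S = proj₂ (CycEdge-endpoints K (Equivalence.to (S=f u _) uv∈S))

decodeCycle : ∀ {n h m} → Kind → (Fin h → Fin n) → Vec (Fin n) m → Vec (Fin (h + m)) h → EdgeSet n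
decodeCycle K f w ρ = cycleEdges K (lookup (Vec.tabulate f Vec.++ w) ∘ lookup ρ)

module _ {n h} (m : ℕ) (K : Kind) {f g : Fin h → Fin n} (S T : EdgeSet n)
  (f-inj : Injective _≡_ _≡_ f) (S=f : IsCycleEdges K f S)
  (g-inj : Injective _≡_ _≡_ g) (T=g : IsCycleEdges K g T)
  (small-union : ∣ vset S ∪ vset T ∣ ≤ h + m) where

  private
    outside? : Decidable (λ v → lookup (vset S) v ≡ false)
    outside? v = lookup (vset S) v ≟ᴮ false

    newVertices : List (Fin n)
    newVertices = filter outside? (List.tabulate g)

    newVertices⊆image : ∀ {v} → v ∈ newVertices → ∃ λ k → v ≡ g k
    newVertices⊆image v∈new = ∈-tabulate⁻ (proj₁ (∈-filter⁻ outside? {xs = List.tabulate g} v∈new))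

    length-newVertices : length newVertices ≤ m
    length-newVertices = +-cancelˡ-≤ h _ _ (begin
      h + length newVertices                        ≡⟨ cong (_+ length newVertices) (length-tabulate f) ⟨
      length (List.tabulate f) + length newVertices ≡⟨ length-++ (List.tabulate f) ⟨
      length (List.tabulate f ++ newVertices)       ≤⟨ Unique⇒length≤∣∣ (vset S ∪ vset T) unique ⊆union ⟩
      ∣ vset S ∪ vset T ∣                           ≤⟨ small-union ⟩
      h + m                                         ∎)
      where
      open ≤-Reasoning
      disjoint : Disjoint (List.tabulate f) newVertices
      disjoint (v∈f , v∈new) with k , refl ← ∈-tabulate⁻ v∈f
        with () ← trans (sym (image⊆vset S S=f k)) (proj₂ (∈-filter⁻ outside? {xs = List.tabulate g} v∈new))
      unique : Unique (List.tabulate f ++ newVertices)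
      unique = ++⁺ (tabulate⁺ f-inj) (filter⁺ outside? (tabulate⁺ g-inj)) disjoint
      ⊆union : ∀ {v} → v ∈ List.tabulate f ++ newVertices → lookup (vset S ∪ vset T) v ≡ true
      ⊆union v∈ with ∈-++⁻ (List.tabulate f) v∈
      ... | inj₁ v∈f   with k , refl ← ∈-tabulate⁻ v∈f       = ∪-trueˡ (vset S) (vset T) (image⊆vset S S=f k)
      ... | inj₂ v∈new with k , refl ← newVertices⊆image v∈new = ∪-trueʳ (vset S) (vset T) (image⊆vset T T=g k)

    image-located : ∀ k → (∃ λ k′ → g k ≡ f k′) ⊎ g k ∈ newVertices
    image-located k with lookup (vset S) (g k) in gk
    ... | true  = inj₁ (vset⊆image S S=f gk)
    ... | false = inj₂ (∈-filter⁺ outside? (∈-tabulate⁺ k) gk)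

    newVertices⊆ : ∀ {vs} → (∀ k → g k ∈ vs) → newVertices ⊆ vs
    newVertices⊆ g⊆vs v∈new with k , refl ← newVertices⊆image v∈new = g⊆vs k

    decodable : (w : Vec (Fin n) m) → (∀ {v} → v ∈ newVertices → ∃ λ r → lookup w r ≡ v) →
      ∃ λ ρ → decodeCycle K f w ρ ≡ T
    decodable w covers = ρ , sym (IsCycleEdges⇒≡cycleEdges K (IsCycleEdges-resp-≗ K T g≗decoded T=g))
      where
      position : ∀ k → ∃ λ r → lookup (Vec.tabulate f Vec.++ w) r ≡ g k
      position k with image-located k
      ... | inj₁ (k′ , gk≡fk′) =
        k′ ↑ˡ m , trans (lookup-++ˡ (Vec.tabulate f) w k′) (trans (lookup∘tabulate f k′) (sym gk≡fk′))
      ... | inj₂ gk∈new = let r , wr≡gk = covers gk∈new in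
        h ↑ʳ r , trans (lookup-++ʳ (Vec.tabulate f) w r) wr≡gk
      ρ : Vec (Fin (h + m)) h
      ρ = Vec.tabulate (proj₁ ∘ position)
      g≗decoded : g ≗ lookup (Vec.tabulate f Vec.++ w) ∘ lookup ρ
      g≗decoded k = sym (trans (cong (lookup (Vec.tabulate f Vec.++ w)) (lookup∘tabulate (proj₁ ∘ position) k))
                                (proj₂ (position k)))

  encodeCycle : .{{NonZero h}} → {vs : List (Fin n)} → (∀ k → g k ∈ vs) →
    ∃ λ w → ∃ λ ρ → w ∈ vectorsOver vs m × decodeCycle K f w ρ ≡ T
  encodeCycle g⊆vs
    with w , w∈vs^m , covers ← vectorsOver-covers newVertices m (g⊆vs (fromℕ< (>-nonZero⁻¹ h)))
                                 (newVertices⊆ g⊆vs) length-newVertices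
    with ρ , decoded≡T ← decodable w covers
    = w , ρ , w∈vs^m , decoded≡T

module _ (K : Kind) {n} (a : Adj n) (h m : ℕ) .{{_ : NonZero h}}
  (copies : List (EdgeSet n)) (copies-complete : ∀ S → S ∈ copies ⇔ IsCopy K a h S)
  (vs : List (Fin n)) (vs-complete : ∀ v → InSomeCopy K a h v → v ∈ vs) where

  private
    Code : Set
    Code = Fin (length copies) × Vec (Fin n) m × Vec (Fin (h + m)) h

    words : List (Vec (Fin n) m)
    words = vectorsOver vs m

    placements : List (Vec (Fin (h + m)) h)
    placements = vectorsOver (allFin (h + m)) h

    codes : List Code
    codes = cartesianProduct (allFin (length copies)) (cartesianProduct words placements)

    length-codes : length codes ≡ length copies * (length vs ^ m * (h + m) ^ h)
    length-codes =
      trans (length-cartesianProduct (allFin (length copies)) (cartesianProduct words placements))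
        (cong₂ _*_ (length-allFin (length copies))
          (trans (length-cartesianProduct words placements)
            (cong₂ _*_ (length-vectorsOver vs m)
              (trans (length-vectorsOver (allFin (h + m)) h) (cong (_^ h) (length-allFin (h + m)))))))

    copyAt : ∀ j → IsCopy K a h (List.lookup copies j)
    copyAt j = Equivalence.to (copies-complete _) (∈-lookup j)

    param : Fin (length copies) → Fin h → Fin n
    param j = proj₁ (proj₂ (copyAt j))

    param-injective : ∀ j → Injective _≡_ _≡_ (param j)
    param-injective j = proj₁ (proj₂ (proj₂ (copyAt j)))

    param-cycle : ∀ j → IsCycleEdges K (param j) (List.lookup copies j)
    param-cycle j = proj₂ (proj₂ (proj₂ (copyAt j)))

    decode : Code → EdgeSet n × EdgeSet n
    decode (j , w , ρ) = List.lookup copies j , decodeCycle K (param j) w ρ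

    encodeAt : ∀ j {T} → IsCopy K a h T → ∣ vset (List.lookup copies j) ∪ vset T ∣ ≤ h + m →
      (List.lookup copies j , T) ∈ List.map decode codes
    encodeAt j {T} T-copy@(_ , g , g-inj , T=g) small-union
      with w , ρ , w∈ , decode≡T ← encodeCycle m K (List.lookup copies j) T
                                      (param-injective j) (param-cycle j) g-inj T=g small-union
                                      (λ k → vs-complete (g k) (T , T-copy , image⊆vset T T=g k))
      = subst (λ T′ → (List.lookup copies j , T′) ∈ List.map decode codes) decode≡T
          (∈-map⁺ decode (∈-cartesianProduct⁺ (∈-allFin j)
            (∈-cartesianProduct⁺ w∈ (∈-vectorsOver⁺ ρ (∈-allFin ∘ lookup ρ)))))

  length-copyPairs≤ : ∀ {pairs} → Unique pairs →
    (∀ {S T} → (S , T) ∈ pairs → IsCopy K a h S × IsCopy K a h T × ∣ vset S ∪ vset T ∣ ≤ h + m) →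
    length pairs ≤ length copies * (length vs ^ m * (h + m) ^ h)
  length-copyPairs≤ {pairs} pairs-unique pairs-small = begin
    length pairs                ≤⟨ Unique-⊆⇒length≤ pairs-unique pairs⊆decoded ⟩
    length (List.map decode codes) ≡⟨ length-map decode codes ⟩
    length codes                ≡⟨ length-codes ⟩
    length copies * (length vs ^ m * (h + m) ^ h) ∎
    where
    open ≤-Reasoning
    pairs⊆decoded : pairs ⊆ List.map decode codes
    pairs⊆decoded {S , T} p∈pairs
      with S-copy , T-copy , small-union ← pairs-small p∈pairs
      with S∈copies ← Equivalence.from (copies-complete S) S-copy
      = subst (λ S′ → (S′ , T) ∈ List.map decode codes) (sym (lookup-index S∈copies))
          (encodeAt (index S∈copies) T-copy
            (subst (λ S′ → ∣ vset S′ ∪ vset T ∣ ≤ h + m) (lookup-index S∈copies) small-union))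

minLen≤⇒nonZero : ∀ K {h} → minLen K ≤ h → NonZero h
minLen≤⇒nonZero directed   (s≤s _) = _
minLen≤⇒nonZero undirected (s≤s _) = _

claim10 : (K : Kind) (h : ℕ) → minLen K ≤ h →
    (n : ℕ) (a : Adj n) → WellFormed K a →
    (t x : ℕ) → Card (IsCopy K a h) t → Card (InSomeCopy K a h) x →
    (i : ℕ) → h + 1 ≤ i → i ≤ 2 * h ∸ 1 →
    (d : ℕ) → Card (PairUnion K a h i) d →
    d ≤ (2 * h) ^ h * t * x ^ (i ∸ h)
claim10 K h minLen≤h n a _ t x (copies , _ , copies-complete , ∣copies∣≡t) (vs , _ , vs-complete , ∣vs∣≡x)
        i h+1≤i i≤2h∸1 d (pairs , pairs-unique , pairs-complete , ∣pairs∣≡d) = begin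
  d                                             ≡⟨ ∣pairs∣≡d ⟨
  length pairs                                  ≤⟨ length-copyPairs≤ K a h m {{minLen≤⇒nonZero K minLen≤h}}
                                                     copies copies-complete vs (Equivalence.from ∘ vs-complete)
                                                     pairs-unique small-unions ⟩
  length copies * (length vs ^ m * (h + m) ^ h) ≡⟨ cong₂ (λ t′ x′ → t′ * (x′ ^ m * (h + m) ^ h))
                                                           ∣copies∣≡t ∣vs∣≡x ⟩
  t * (x ^ m * (h + m) ^ h)                     ≡⟨ cong (λ k → t * (x ^ m * k ^ h)) h+m≡i ⟩
  t * (x ^ m * i ^ h)                           ≤⟨ *-monoʳ-≤ t (*-monoʳ-≤ (x ^ m) (^-monoˡ-≤ h i≤2h)) ⟩
  t * (x ^ m * (2 * h) ^ h)                     ≡⟨ reorder t (x ^ m) ((2 * h) ^ h) ⟩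
  (2 * h) ^ h * t * x ^ m                       ∎
  where
  open ≤-Reasoning
  m : ℕ
  m = i ∸ h
  h+m≡i : h + m ≡ i
  h+m≡i = m+[n∸m]≡n (≤-trans (m≤m+n h 1) h+1≤i)
  i≤2h : i ≤ 2 * h
  i≤2h = ≤-trans i≤2h∸1 (m∸n≤m (2 * h) 1)
  small-unions : ∀ {S T} → (S , T) ∈ pairs → IsCopy K a h S × IsCopy K a h T × ∣ vset S ∪ vset T ∣ ≤ h + m
  small-unions p∈pairs with S-copy , T-copy , ∣S∪T∣≡i ← Equivalence.to (pairs-complete _) p∈pairs =
    S-copy , T-copy , ≤-reflexive (trans ∣S∪T∣≡i (sym h+m≡i))
  reorder : ∀ t y c → t * (y * c) ≡ c * t * y
  reorder = solve-∀
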